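{- Let $\mathcal{P}$ be the Point Algebra, let $X$ be a set, and let $\theta:\mathcal{P}\to\wp(X\times X)$ be any map such that for all $a,b\in\mathcal{P}$ we have $(-a)^\theta=(X\times X)\setminus a^\theta$ and $(a;b)^\theta=a^\theta;b^\theta$. Suppose there is $x_0\in X$ with $(x_0,x_0)\in 1^\theta$. Then for every $n<\omega$ there exist $x_1,\dots,x_n\in X$ such that for all $0\le i<j\le n$: $x_i\neq x_j$, $(x_i,x_j)\in (\leq)^\theta$ and $(x_j,x_i)\in (>)^\theta$.
   Context: The Point Algebra $\mathcal{P}$ is the set of eight binary relations on $\mathbb{Q}$: $0=\emptyset$, $1=\mathbb{Q}\times\mathbb{Q}$, and the arithmetic relations $=,\neq,<,\leq,>,\geq$ on $\mathbb{Q}$ (here $\leq$ and $>$ denote these elements of $\mathcal{P}$); it is closed under complement $-a=(\mathbb{Q}\times\mathbb{Q})\setminus a$, union, intersection, converse and relational composition. For binary relations $R,S$ on a set, $R;S=\{(x,z)\mid \exists y\,((x,y)\in R \wedge (y,z)\in S)\}$. The value of $\theta$ at $a$ is written $a^\theta$. -}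

module Defs where

open import Data.Bool using (Bool; true; false; _∧_; _∨_; not; T)
open import Data.Product using (_×_; Σ)
open import Data.Sum using (_⊎_)
open import Data.Empty using (⊥)
open import Function.Bundles using (_⇔_)
open import Relation.Nullary using (¬_)
open import Relation.Binary.PropositionalEquality using (_≡_)
import Data.Rational as ℚ
open ℚ using (ℚ)

-- The Point Algebra.  Every element of 𝒫 is a union of the three
-- "atoms" <, =, > of ℚ (these partition ℚ × ℚ), so an element is
-- represented by which atoms it contains.
record 𝒫 : Set where
  constructor ⟨_,_,_⟩
  field
    lt eq gt : Bool
open 𝒫 public

⟦_⟧ : 𝒫 → ℚ → ℚ → Set
⟦ a ⟧ x y = (T (lt a) × x ℚ.< y) ⊎ (T (eq a) × x ≡ y) ⊎ (T (gt a) × y ℚ.< x)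

0ᴾ 1ᴾ =ᴾ ≠ᴾ <ᴾ ≤ᴾ >ᴾ ≥ᴾ : 𝒫
0ᴾ = ⟨ false , false , false ⟩
1ᴾ = ⟨ true  , true  , true  ⟩
=ᴾ = ⟨ false , true  , false ⟩
≠ᴾ = ⟨ true  , false , true  ⟩
<ᴾ = ⟨ true  , false , false ⟩
≤ᴾ = ⟨ true  , true  , false ⟩
>ᴾ = ⟨ false , false , true  ⟩
≥ᴾ = ⟨ false , true  , true  ⟩

-ᴾ_ : 𝒫 → 𝒫
-ᴾ a = ⟨ not (lt a) , not (eq a) , not (gt a) ⟩

-- Relational composition on ℚ (dense, no endpoints), computed atomwise:
--   <;< = <,  <;= = <,  <;> = 1,  =;c = c,  >;< = 1,  >;= = >,  >;> = >.
_⨾_ : 𝒫 → 𝒫 → 𝒫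
a ⨾ b = ⟨ (lt a ∧ (lt b ∨ eq b ∨ gt b)) ∨ (eq a ∧ lt b) ∨ (gt a ∧ lt b)
        , (lt a ∧ gt b) ∨ (eq a ∧ eq b) ∨ (gt a ∧ lt b)
        , (gt a ∧ (gt b ∨ eq b ∨ lt b)) ∨ (eq a ∧ gt b) ∨ (lt a ∧ gt b) ⟩

Rel : Set → Set₁
Rel X = X → X → Set

compl : {X : Set} → Rel X → Rel X
compl R x y = ¬ R x y

_∘ᴿ_ : {X : Set} → Rel X → Rel X → Rel X
(R ∘ᴿ S) x z = Σ _ λ y → R x y × S y z

_≐_ : {X : Set} → Rel X → Rel X → Set
R ≐ S = ∀ x y → R x y ⇔ S x y

-- Inside 𝒫 we have 1 = (≤ ; >), ≤ = -(>), (> ; >) = > and ≤ ; 0 = 0 ; > = 0, and θ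
-- transfers these to X.  So from a loop (x,x) ∈ 1^θ we get y with (x,y) ∈ ≤^θ and
-- (y,x) ∈ >^θ, and (y,y) ∈ 1^θ again, since otherwise (y,y) ∈ 0^θ would force
-- (x,x) ∈ (≤ ; 0 ; >)^θ = 0^θ.  Iterating from x₀ gives a chain descending along the
-- transitive relation >^θ.  For i < j, (x_i,x_j) ∈ >^θ would give, via
-- (x_j,x_{i+1}) ∈ >^θ, that (x_i,x_{i+1}) ∈ >^θ, contradicting (x_i,x_{i+1}) ∈ ≤^θ;
-- hence (x_i,x_j) ∈ ≤^θ, and x_i ≠ x_j because (x_j,x_i) ∈ >^θ.
module Submission where

open import Defs
open import Data.Nat using (ℕ; suc)
open import Data.Fin using (Fin; zero; _<_; toℕ)
open import Data.Product using (_×_; Σ; _,_; proj₁; proj₂)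
open import Relation.Binary.PropositionalEquality using (_≡_; _≢_; refl; sym; subst₂)

import Data.Nat as ℕ
open import Data.Nat.Properties using (m≤n⇒m<n∨m≡n)
open import Data.Sum using (inj₁; inj₂)
open import Function.Bundles using (Equivalence)
open import Relation.Binary.Definitions using (Transitive)
open import Relation.Nullary using (¬_)

module DescendingChain {A : Set} {R : Rel A} (R-trans : Transitive R)
    (s : ℕ → A) (s-step : ∀ k → R (s (suc k)) (s k)) where

  chain-descends : ∀ {i j} → i ℕ.< j → R (s j) (s i)
  chain-descends {j = suc j} (ℕ.s≤s i≤j) with m≤n⇒m<n∨m≡n i≤j
  ... | inj₁ i<j  = R-trans (s-step j) (chain-descends i<j)
  ... | inj₂ refl = s-step j

  chain-step-below : ∀ {i j} → i ℕ.< j → R (s i) (s j) → R (s i) (s (suc i))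
  chain-step-below (ℕ.s≤s i≤j) r with m≤n⇒m<n∨m≡n i≤j
  ... | inj₁ i<j  = R-trans r (chain-descends (ℕ.s≤s i<j))
  ... | inj₂ refl = r

module PointAlgebraImage {X : Set} (θ : 𝒫 → Rel X)
    (θ-compl : ∀ a → θ (-ᴾ a) ≐ compl (θ a))
    (θ-⨾ : ∀ a b → θ (a ⨾ b) ≐ (θ a ∘ᴿ θ b)) where

  θ-⨾-intro : ∀ {a b x y z} → θ a x y → θ b y z → θ (a ⨾ b) x z
  θ-⨾-intro {a} {b} {x} {y} {z} p q = Equivalence.from (θ-⨾ a b x z) (y , p , q)

  θ-⨾-elim : ∀ {a b x z} → θ (a ⨾ b) x z → (θ a ∘ᴿ θ b) x z
  θ-⨾-elim {a} {b} {x} {z} = Equivalence.to (θ-⨾ a b x z)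

  θ->-trans : Transitive (θ >ᴾ)
  θ->-trans = θ-⨾-intro {>ᴾ} {>ᴾ}

  θ-≤⇒¬> : ∀ {x y} → θ ≤ᴾ x y → ¬ θ >ᴾ x y
  θ-≤⇒¬> {x} {y} = Equivalence.to (θ-compl >ᴾ x y)

  θ-¬>⇒≤ : ∀ {x y} → ¬ θ >ᴾ x y → θ ≤ᴾ x y
  θ-¬>⇒≤ {x} {y} = Equivalence.from (θ-compl >ᴾ x y)

  Loop : X → Set
  Loop x = θ 1ᴾ x x

  θ-0-loop-pullback : ∀ {x y} → θ ≤ᴾ x y → θ >ᴾ y x → θ 0ᴾ y y → θ 0ᴾ x x
  θ-0-loop-pullback p q z = θ-⨾-intro {0ᴾ} {>ᴾ} (θ-⨾-intro {≤ᴾ} {0ᴾ} p z) q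

  record Successor (x : X) : Set where
    field
      point : X
      below : θ ≤ᴾ x point
      above : θ >ᴾ point x
      loop  : Loop point

  successor : ∀ {x} → Loop x → Successor x
  successor {x} ℓ with θ-⨾-elim {≤ᴾ} {>ᴾ} ℓ
  ... | y , p , q = record { point = y ; below = p ; above = q ; loop = y-loop }
    where
    y-loop : Loop y
    y-loop = Equivalence.from (θ-compl 0ᴾ y y) λ z →
      Equivalence.to (θ-compl 0ᴾ x x) ℓ (θ-0-loop-pullback p q z)

  LoopPoint : Set
  LoopPoint = Σ X Loop

  next : LoopPoint → LoopPoint
  next (x , ℓ) = Successor.point s , Successor.loop s
    where s = successor ℓ

  iterate : LoopPoint → ℕ → LoopPoint
  iterate p 0       = p
  iterate p (suc k) = next (iterate p k)

  module Chain (p₀ : LoopPoint) where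

    xs : ℕ → X
    xs k = proj₁ (iterate p₀ k)

    xs-step : ∀ k → θ >ᴾ (xs (suc k)) (xs k)
    xs-step k = Successor.above (successor (proj₂ (iterate p₀ k)))

    open DescendingChain {R = θ >ᴾ} θ->-trans xs xs-step

    xs-> : ∀ {i j} → i ℕ.< j → θ >ᴾ (xs j) (xs i)
    xs-> = chain-descends

    xs-≤ : ∀ {i j} → i ℕ.< j → θ ≤ᴾ (xs i) (xs j)
    xs-≤ {i} i<j = θ-¬>⇒≤ λ r →
      θ-≤⇒¬> (Successor.below (successor (proj₂ (iterate p₀ i)))) (chain-step-below i<j r)

    xs-injective : ∀ {i j} → i ℕ.< j → xs i ≢ xs j
    xs-injective i<j e = θ-≤⇒¬> (xs-≤ i<j) (subst₂ (θ >ᴾ) (sym e) e (xs-> i<j))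

lemma3 : (X : Set) (θ : 𝒫 → Rel X)
         → (∀ a → θ (-ᴾ a) ≐ compl (θ a))
         → (∀ a b → θ (a ⨾ b) ≐ (θ a ∘ᴿ θ b))
         → (x₀ : X) → θ 1ᴾ x₀ x₀
         → (n : ℕ) → Σ (Fin (suc n) → X) λ xs → xs zero ≡ x₀
             × (∀ i j → i < j → xs i ≢ xs j × θ ≤ᴾ (xs i) (xs j) × θ >ᴾ (xs j) (xs i))
lemma3 X θ θ-compl θ-⨾ x₀ ℓ₀ n =
  (λ i → xs (toℕ i)) , refl , λ i j i<j → xs-injective i<j , xs-≤ i<j , xs-> i<j
  where
  open PointAlgebraImage θ θ-compl θ-⨾
  open Chain (x₀ , ℓ₀)
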